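{- Let $m,n\ge1$ and let $[P',Q']$ be an interval of $\mathbb{D}_{m,n}$. Delete in $P'$ and $Q'$ the final large peak $U^mD^m$ (i.e. write $P'=AU^mD^h$ with $h\ge m$ and replace it by $AD^{h-m}$, and similarly for $Q'$), obtaining paths $P,Q\in\mathbb{D}_{m,n-1}$. Then $P\le Q$. Conversely, let $[P,Q]$ be an interval of $\mathbb{D}_{m,n-1}$ and let $a\le b$ be the lengths of the final descents of $P$ and $Q$. Insert a large peak $U^mD^m$ into the final descent of $P$ starting at height $a'\in\{0,\dots,a\}$ (i.e. $P=AD^a$ becomes $AD^{a-a'}U^mD^{m+a'}$), and similarly into the final descent of $Q$ at height $b'\in\{0,\dots,b\}$, obtaining $P',Q'$. Then $P'\le Q'$ if and only if $a'\le b'$ and ($a'=a$ implies $b'=b$).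
   Context: Dyck paths of size $N$: lattice paths from $(0,0)$ with $N$ steps $U=(1,1)$ and $N$ steps $D=(1,-1)$, ending on the $x$-axis, never below it (the empty path for $N=0$). A descent is a maximal run of down steps; the final descent is the last one. $\mathbb{D}_N$: Dyck paths of size $N$ ordered by the reflexive-transitive closure of replacing a factor $DU^kD$ ($k\ge1$) by $U^kDD$. $\mathbb{D}_{m,n}$: Dyck paths of size $mn$ whose maximal runs of up steps all have length a multiple of $m$, with the order induced from $\mathbb{D}_{mn}$. An interval is a pair $P\le Q$. -}

module Defs where

open import Data.Nat using (ℕ; zero; suc; _*_; _≤_)
open import Data.Nat.Divisibility using (_∣_)
open import Data.List using (List; []; _∷_; _++_; replicate; length)
open import Data.Product using (∃; _×_)
open import Relation.Nullary using (¬_)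
open import Relation.Binary.PropositionalEquality using (_≡_)
open import Relation.Binary.Construct.Closure.ReflexiveTransitive using (Star)

-- Steps: U = (1,1), D = (1,-1). A path is the word of its steps.
data Step : Set where
  U D : Step

Path : Set
Path = List Step

-- NonNeg h w : starting at height h, the path w never goes below the
-- x-axis and ends on the x-axis.
data NonNeg : ℕ → Path → Set where
  nil  : NonNeg 0 []
  up   : ∀ {h w} → NonNeg (suc h) w → NonNeg h (U ∷ w)
  down : ∀ {h w} → NonNeg h w → NonNeg (suc h) (D ∷ w)

IsDyck : ℕ → Path → Set
IsDyck N w = NonNeg 0 w × length w ≡ 2 * N

EndsWith : Step → Path → Set
EndsWith s w = ∃ λ A → w ≡ A ++ (s ∷ [])

StartsWith : Step → Path → Set
StartsWith s w = ∃ λ B → w ≡ s ∷ B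

UpRunsMultipleOf : ℕ → Path → Set
UpRunsMultipleOf m w =
  ∀ A k B → w ≡ A ++ replicate k U ++ B →
  ¬ EndsWith U A → ¬ StartsWith U B → 1 ≤ k → m ∣ k

InDmn : ℕ → ℕ → Path → Set
InDmn m n w = IsDyck (m * n) w × UpRunsMultipleOf m w

data _⟶_ : Path → Path → Set where
  rot : ∀ A B k → 1 ≤ k →
        (A ++ D ∷ replicate k U ++ D ∷ B) ⟶ (A ++ replicate k U ++ D ∷ D ∷ B)

_≤D_ : Path → Path → Set
P ≤D Q = Star _⟶_ P Q

-- Every path factors uniquely as A D^f with A not ending in D; D^f is its final descent.
-- A move either acts inside A, leaving the final descent alone, or rotates the factor
-- D U^k D whose last D begins the final descent: then A = C D U^k becomes C U^k and the
-- final descent grows by one.  Deleting the final large peak turns each move into at most one move, the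
-- height condition supplying the D that the second case needs.  For insertion, writing
-- P_c for P with the peak inserted at height c, P ≤ Q yields P_c ≤ Q_c for every c below
-- the final descent a of P, and P_a ≤ Q_b;
-- raising the inserted peak inside a final descent is itself a move, which gives
-- sufficiency.  Conversely the final descent of P′ has length m + a′ and moves never
-- shorten it, nor the last ascent: when a′ = a the last ascent of P′ is longer than m,
-- which forces the peak of Q′ to sit on top of its final descent, i.e. b′ = b.

module Submission where

open import Defs
open import Data.Nat using (ℕ; zero; suc; _≤_; _<_; _∸_; _+_; _*_; z≤n; s≤s)
open import Data.Nat.Properties
open import Data.List using ([]; _∷_; _++_; replicate; length; [_])
open import Data.List.Properties
  using (++-assoc; ++-identityʳ; ++-cancelʳ; ∷-injective; ∷-injectiveˡ; ∷-injectiveʳ; ∷ʳ-injective;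
         length-++; length-replicate)
open import Data.Product using (_×_; _,_; ∃; ∃₂; proj₁; proj₂)
open import Data.Sum using (_⊎_; inj₁; inj₂)
open import Data.Empty using (⊥-elim)
open import Relation.Nullary using (¬_)
open import Relation.Binary.PropositionalEquality hiding ([_])
open import Relation.Binary.Construct.Closure.ReflexiveTransitive using (ε; _◅_; _◅◅_)
open import Data.Nat.Divisibility using (_∣_; ∣m+n∣m⇒∣n; ∣-refl)
open import Function.Bundles using (_⇔_; mk⇔)
open import Data.Nat.Tactic.RingSolver using (solve-∀)

-- Words over {U, D}

levi : ∀ (X Y Z W : Path) → X ++ Y ≡ Z ++ W →
  (∃ λ M → Z ≡ X ++ M × Y ≡ M ++ W) ⊎ (∃₂ λ x M → X ≡ Z ++ x ∷ M × W ≡ x ∷ M ++ Y)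
levi []      Y Z       W eq = inj₁ (Z , refl , eq)
levi (x ∷ X) Y []      W eq = inj₂ (x , X , refl , sym eq)
levi (x ∷ X) Y (z ∷ Z) W eq with ∷-injective eq
... | refl , eq′ with levi X Y Z W eq′
...   | inj₁ (M , p , q)     = inj₁ (M , cong (x ∷_) p , q)
...   | inj₂ (y , M , p , q) = inj₂ (y , M , cong (x ∷_) p , q)

++-assoc₃ : ∀ (C R M T : Path) → (C ++ R ++ M) ++ T ≡ C ++ R ++ M ++ T
++-assoc₃ C R M T = trans (++-assoc C (R ++ M) T) (cong (C ++_) (++-assoc R M T))

replicate-+ : ∀ (s : Step) j k → replicate (j + k) s ≡ replicate j s ++ replicate k s
replicate-+ s zero    k = refl
replicate-+ s (suc j) k = cong (s ∷_) (replicate-+ s j k)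

++-replicate-merge : ∀ X (s : Step) j k T →
                     (X ++ replicate j s) ++ replicate k s ++ T ≡ X ++ replicate (j + k) s ++ T
++-replicate-merge X s j k T = trans (++-assoc X _ _)
  (cong (X ++_) (trans (sym (++-assoc (replicate j s) _ T)) (cong (_++ T) (sym (replicate-+ s j k)))))

replicate-∷ʳ : ∀ (s : Step) j → replicate (suc j) s ≡ replicate j s ++ [ s ]
replicate-∷ʳ s zero    = refl
replicate-∷ʳ s (suc j) = cong (s ∷_) (replicate-∷ʳ s j)

replicate-∷-++ : ∀ (s : Step) t X → s ∷ replicate t s ++ X ≡ replicate t s ++ s ∷ X
replicate-∷-++ s zero    X = refl
replicate-∷-++ s (suc t) X = cong (s ∷_) (replicate-∷-++ s t X)

prefix-replicate : ∀ (N M : Path) s j → N ++ M ≡ replicate j s → N ≡ replicate (length N) s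
prefix-replicate []      M s j       eq = refl
prefix-replicate (x ∷ N) M s zero    ()
prefix-replicate (x ∷ N) M s (suc j) eq with ∷-injective eq
... | refl , eq′ = cong (x ∷_) (prefix-replicate N M s j eq′)

¬startsWith-U-replicate-D : ∀ h → ¬ StartsWith U (replicate h D)
¬startsWith-U-replicate-D zero    (_ , ())
¬startsWith-U-replicate-D (suc h) (_ , ())

¬endsWith-[] : ∀ {s} → ¬ EndsWith s []
¬endsWith-[] ([]    , ())
¬endsWith-[] (_ ∷ _ , ())

endsWith-functional : ∀ {s t X} → EndsWith s X → EndsWith t X → s ≡ t
endsWith-functional (A , refl) (B , eq) = proj₂ (∷ʳ-injective A B eq)

endsWith-U⇒¬endsWith-D : ∀ {X} → EndsWith U X → ¬ EndsWith D X
endsWith-U⇒¬endsWith-D eU eD with endsWith-functional eU eD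
... | ()

endsWith-replicate : ∀ s j → EndsWith s (replicate (suc j) s)
endsWith-replicate s j = replicate j s , replicate-∷ʳ s j

endsWith-++⁺ : ∀ {s} X {Y} → EndsWith s Y → EndsWith s (X ++ Y)
endsWith-++⁺ {s} X (Z , refl) = X ++ Z , sym (++-assoc X Z [ s ])

endsWith-++⁻ : ∀ {s} X {y M} → EndsWith s (X ++ y ∷ M) → EndsWith s (y ∷ M)
endsWith-++⁻ []          e                = e
endsWith-++⁻ (x ∷ [])    ([] , ())
endsWith-++⁻ (x ∷ _ ∷ X) ([] , ())
endsWith-++⁻ (x ∷ X)     (_ ∷ Z , eq)      = endsWith-++⁻ X (Z , ∷-injectiveʳ eq)

endsWith-last : ∀ x (X : Path) → ∃ λ s → EndsWith s (x ∷ X)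
endsWith-last x []      = x , [] , refl
endsWith-last x (y ∷ X) with endsWith-last y X
... | s , Z , eq = s , x ∷ Z , cong (x ∷_) eq

¬endsWith-D-++-ups : ∀ X j → ¬ EndsWith D (X ++ replicate (suc j) U)
¬endsWith-D-++-ups X j = endsWith-U⇒¬endsWith-D (endsWith-++⁺ X (endsWith-replicate U j))

endsWith-D-++-downs : ∀ A f → EndsWith D (A ++ replicate (suc f) D)
endsWith-D-++-downs A f = endsWith-++⁺ A (endsWith-replicate D f)

endsWith-U-++-downs : ∀ B i → EndsWith U (B ++ replicate i D) → i ≡ 0
endsWith-U-++-downs B zero    _  = refl
endsWith-U-++-downs B (suc i) eU = ⊥-elim (endsWith-U⇒¬endsWith-D eU (endsWith-D-++-downs B i))

FinalDescent : Path → Path → ℕ → Set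
FinalDescent W A f = W ≡ A ++ replicate f D × ¬ EndsWith D A

finalDescent : ∀ W → ∃₂ (FinalDescent W)
finalDescent []      = [] , 0 , refl , ¬endsWith-[]
finalDescent (x ∷ W) with finalDescent W
finalDescent (D ∷ W) | []    , f , refl , _  = [] , suc f , refl , ¬endsWith-[]
finalDescent (U ∷ W) | []    , f , refl , _  = [ U ] , f , refl , endsWith-U⇒¬endsWith-D ([] , refl)
finalDescent (x ∷ W) | y ∷ A , f , refl , ¬e =
  x ∷ y ∷ A , f , refl , λ e → ¬e (endsWith-++⁻ [ x ] e)

++-replicate-∷ʳ : ∀ A (s : Step) f → A ++ replicate (suc f) s ≡ (A ++ replicate f s) ++ [ s ]
++-replicate-∷ʳ A s f = trans (cong (A ++_) (replicate-∷ʳ s f)) (sym (++-assoc A _ [ s ]))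

finalDescent-unique : ∀ {W A f B g} → FinalDescent W A f → FinalDescent W B g → A ≡ B × f ≡ g
finalDescent-unique {A = A} {f} {B} {g} (refl , ¬eA) (eq , ¬eB) = unique f g eq
  where
  unique : ∀ f g → A ++ replicate f D ≡ B ++ replicate g D → A ≡ B × f ≡ g
  unique zero    zero    eq = trans (sym (++-identityʳ A)) (trans eq (++-identityʳ B)) , refl
  unique zero    (suc g) eq =
    ⊥-elim (¬eA (subst (EndsWith D) (sym (trans (sym (++-identityʳ A)) eq)) (endsWith-D-++-downs B g)))
  unique (suc f) zero    eq =
    ⊥-elim (¬eB (subst (EndsWith D) (trans eq (++-identityʳ B)) (endsWith-D-++-downs A f)))
  unique (suc f) (suc g) eq with ∷ʳ-injective (A ++ replicate f D) (B ++ replicate g D)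
    (trans (sym (++-replicate-∷ʳ A D f)) (trans eq (++-replicate-∷ʳ B D g)))
  ... | eq′ , _ with unique f g eq′
  ...   | A≡B , f≡g = A≡B , cong suc f≡g

split-after : ∀ {s t} → s ≢ t → ∀ Z M X j → EndsWith t Z → Z ++ M ≡ X ++ replicate j s →
              ∃ λ M′ → X ≡ Z ++ M′ × M ≡ M′ ++ replicate j s
split-after {s} s≢t Z M X j eZ eq with levi Z M X (replicate j s) eq
... | inj₁ (M′ , X≡ , M≡) = M′ , X≡ , M≡
... | inj₂ (x , N , Z≡ , q) = ⊥-elim (s≢t (endsWith-functional (subst (EndsWith s) (sym Z≡) eZ′) eZ))
  where
  eZ′ : EndsWith s (X ++ x ∷ N)
  eZ′ = endsWith-++⁺ X (subst (EndsWith s) (sym (prefix-replicate (x ∷ N) M s j (sym q)))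
                                          (endsWith-replicate s (length N)))

-- Heights

nonNeg-ups⁻ : ∀ k {c w} → NonNeg c (replicate k U ++ w) → NonNeg (k + c) w
nonNeg-ups⁻ zero    p      = p
nonNeg-ups⁻ (suc k) {c} {w} (up p) = subst (λ z → NonNeg z w) (+-suc k c) (nonNeg-ups⁻ k p)

nonNeg-ups⁺ : ∀ k {c w} → NonNeg (k + c) w → NonNeg c (replicate k U ++ w)
nonNeg-ups⁺ zero    p = p
nonNeg-ups⁺ (suc k) {c} {w} p = up (nonNeg-ups⁺ k (subst (λ z → NonNeg z w) (sym (+-suc k c)) p))

nonNeg-downs⁻ : ∀ j {c} → NonNeg c (replicate j D) → c ≡ j
nonNeg-downs⁻ zero    nil      = refl
nonNeg-downs⁻ (suc j) (down p) = cong suc (nonNeg-downs⁻ j p)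

nonNeg-downs⁺ : ∀ j → NonNeg j (replicate j D)
nonNeg-downs⁺ zero    = nil
nonNeg-downs⁺ (suc j) = down (nonNeg-downs⁺ j)

nonNeg-suffix : ∀ X {c Y} → NonNeg c (X ++ Y) → ∃ λ d → NonNeg d Y
nonNeg-suffix []      p        = _ , p
nonNeg-suffix (U ∷ X) (up p)   = nonNeg-suffix X p
nonNeg-suffix (D ∷ X) (down p) = nonNeg-suffix X p

nonNeg-replace-suffix : ∀ X {Y Y′} → (∀ {d} → NonNeg d Y → NonNeg d Y′) →
                        ∀ {c} → NonNeg c (X ++ Y) → NonNeg c (X ++ Y′)
nonNeg-replace-suffix []      f p        = f p
nonNeg-replace-suffix (U ∷ X) f (up p)   = up (nonNeg-replace-suffix X f p)
nonNeg-replace-suffix (D ∷ X) f (down p) = down (nonNeg-replace-suffix X f p)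

nonNeg-peak : ∀ X j h {c} → NonNeg c (X ++ replicate j U ++ replicate h D) → j ≤ h
nonNeg-peak X j h p with nonNeg-suffix X p
... | d , q = subst (j ≤_) (nonNeg-downs⁻ h (nonNeg-ups⁻ j q)) (m≤m+n j d)

nonNeg-⟶ : ∀ {W W′} → W ⟶ W′ → ∀ {c} → NonNeg c W → NonNeg c W′
nonNeg-⟶ (rot A B k _) = nonNeg-replace-suffix A rotate
  where
  rotate : ∀ {d} → NonNeg d (D ∷ replicate k U ++ D ∷ B) → NonNeg d (replicate k U ++ D ∷ D ∷ B)
  rotate (down {h = d} p) =
    nonNeg-ups⁺ k (subst (λ z → NonNeg z (D ∷ D ∷ B)) (sym (+-suc k d)) (down (nonNeg-ups⁻ k p)))

-- Moves

⟶-++ʳ : ∀ {X Y} T → X ⟶ Y → (X ++ T) ⟶ (Y ++ T)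
⟶-++ʳ T (rot A B k k≥1) =
  subst₂ _⟶_ (sym (++-assoc₃ A (D ∷ replicate k U) (D ∷ B) T))
             (sym (++-assoc₃ A (replicate k U) (D ∷ D ∷ B) T))
             (rot A (B ++ T) k k≥1)

⟶-reflects-endsWith-D : ∀ {X Y} → X ⟶ Y → EndsWith D Y → EndsWith D X
⟶-reflects-endsWith-D (rot A B k _) e =
  subst (EndsWith D) (++-assoc A (D ∷ replicate k U) (D ∷ B))
    (endsWith-++⁺ (A ++ D ∷ replicate k U)
      (endsWith-++⁻ (A ++ replicate k U ++ [ D ]) (subst (EndsWith D) Y≡ e)))
  where
  Y≡ : A ++ replicate k U ++ D ∷ D ∷ B ≡ (A ++ replicate k U ++ [ D ]) ++ D ∷ B
  Y≡ = sym (++-assoc₃ A (replicate k U) [ D ] (D ∷ B))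

rotate : ∀ C l R → ((C ++ D ∷ replicate (suc l) U) ++ D ∷ R) ⟶ ((C ++ replicate (suc l) U) ++ D ∷ D ∷ R)
rotate C l R = subst₂ _⟶_ (sym (++-assoc C _ _)) (sym (++-assoc C _ _)) (rot C R (suc l) (s≤s z≤n))

D-across-ups : ∀ C l t → l ≤ t →
               ((C ++ D ∷ replicate l U) ++ replicate t D) ≤D ((C ++ replicate l U) ++ replicate (suc t) D)
D-across-ups C zero    t       _ = subst (((C ++ [ D ]) ++ replicate t D) ≤D_)
  (trans (++-assoc C [ D ] _) (cong (_++ D ∷ replicate t D) (sym (++-identityʳ C)))) ε
D-across-ups C (suc l) (suc t) _ = rotate C l (replicate t D) ◅ ε

∷≡replicate : ∀ {x s : Step} {E} f → x ∷ E ≡ replicate f s →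
              ∃ λ f₁ → f ≡ suc f₁ × E ≡ replicate f₁ s
∷≡replicate zero     ()
∷≡replicate (suc f₁) eq = f₁ , refl , ∷-injectiveʳ eq

data FinalDescentMove (A : Path) (f : ℕ) (W′ : Path) : Set where
  internal : ∀ {A′} → A ⟶ A′ → W′ ≡ A′ ++ replicate f D → FinalDescentMove A f W′
  final    : ∀ C k f₁ → A ≡ C ++ D ∷ replicate (suc k) U → f ≡ suc f₁ →
             W′ ≡ (C ++ replicate (suc k) U) ++ replicate (suc f) D → FinalDescentMove A f W′

finalDescentMove : ∀ {W W′ A f} → W ⟶ W′ → FinalDescent W A f → FinalDescentMove A f W′
finalDescentMove (rot C E zero ())
finalDescentMove {A = A} {f} (rot C E (suc k) k≥1) (eq , _)
  with split-after (λ ()) (C ++ D ∷ replicate (suc k) U) (D ∷ E) A f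
         (endsWith-++⁺ C (endsWith-++⁺ [ D ] (endsWith-replicate U k))) (trans (++-assoc C _ (D ∷ E)) eq)
... | [] , A≡ , D∷E≡ with ∷≡replicate f D∷E≡
...   | f₁ , refl , refl =
  final C k f₁ (trans A≡ (++-identityʳ _)) refl (sym (++-assoc C (replicate (suc k) U) _))
finalDescentMove {A = A} {f} (rot C E (suc k) k≥1) (eq , _)
    | y ∷ M , A≡ , D∷E≡ with ∷-injective D∷E≡
...   | refl , refl =
  internal (subst (_⟶ _) (sym (trans A≡ (++-assoc C (D ∷ R) (D ∷ M)))) (rot C M (suc k) k≥1))
           (sym (++-assoc₃ C R (D ∷ D ∷ M) (replicate f D)))
  where
  R = replicate (suc k) U

⟶-++-ups : ∀ {W Y} X j → W ⟶ Y → W ≡ X ++ replicate j U →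
           ∃ λ X′ → X ⟶ X′ × Y ≡ X′ ++ replicate j U
⟶-++-ups X j (rot C B k k≥1) eq
  with split-after (λ ()) (C ++ D ∷ replicate k U ++ [ D ]) B X j
         (endsWith-++⁺ C (endsWith-++⁺ (D ∷ replicate k U) ([] , refl)))
         (trans (++-assoc₃ C (D ∷ replicate k U) [ D ] B) eq)
... | B′ , X≡ , refl =
  C ++ replicate k U ++ D ∷ D ∷ B′ ,
  subst (_⟶ _) (sym (trans X≡ (++-assoc₃ C (D ∷ replicate k U) [ D ] B′))) (rot C B′ k k≥1) ,
  sym (++-assoc₃ C (replicate k U) (D ∷ D ∷ B′) (replicate j U))

data PeakMove (j : ℕ) (X : Path) (h : ℕ) (W′ : Path) : Set where
  beforePeak : ∀ {X′} → X ⟶ X′ → W′ ≡ X′ ++ replicate j U ++ replicate h D → PeakMove j X h W′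
  intoPeak   : ∀ C l → X ≡ C ++ D ∷ replicate l U →
               W′ ≡ (C ++ replicate l U) ++ replicate j U ++ replicate (suc h) D → PeakMove j X h W′

peakMove : ∀ {W W′} X j h → W ⟶ W′ → W ≡ X ++ replicate (suc j) U ++ replicate h D →
           PeakMove (suc j) X h W′
peakMove X j h mv eq with finalDescentMove mv (trans eq (sym (++-assoc X _ _)) , ¬endsWith-D-++-ups X j)
... | internal XU⟶A′ W′≡ with ⟶-++-ups X (suc j) XU⟶A′ refl
...   | X′ , X⟶X′ , refl = beforePeak X⟶X′ (trans W′≡ (++-assoc X′ _ _))
peakMove X j h mv eq | final C k f₁ XU≡ refl W′≡
  with split-after (λ ()) (C ++ [ D ]) (replicate (suc k) U) X (suc j) (endsWith-++⁺ C ([] , refl))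
         (trans (++-assoc C [ D ] _) (sym XU≡))
... | M , X≡ , Uk≡ = intoPeak C l (trans X≡ (trans (++-assoc C [ D ] M) (cong (λ z → C ++ D ∷ z) M≡)))
  (trans W′≡ (begin
    (C ++ replicate (suc k) U) ++ Dh        ≡⟨ cong (λ z → (C ++ z) ++ Dh) (trans Uk≡ (cong (_++ Uj) M≡)) ⟩
    (C ++ replicate l U ++ Uj) ++ Dh        ≡⟨ ++-assoc₃ C (replicate l U) Uj Dh ⟩
    C ++ replicate l U ++ Uj ++ Dh          ≡⟨ ++-assoc C (replicate l U) (Uj ++ Dh) ⟨
    (C ++ replicate l U) ++ Uj ++ Dh        ∎))
  where
  open ≡-Reasoning
  l = length M
  Uj = replicate (suc j) U
  Dh = replicate (suc (suc f₁)) D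
  M≡ : M ≡ replicate l U
  M≡ = prefix-replicate M Uj U (suc k) (sym Uk≡)

LastAscentAtLeast : ℕ → Path → Set
LastAscentAtLeast j W = ∃₂ λ X h → W ≡ X ++ replicate j U ++ replicate h D

lastAscentAtLeast-≤D : ∀ j {W W′} → W ≤D W′ →
                       LastAscentAtLeast (suc j) W → LastAscentAtLeast (suc j) W′
lastAscentAtLeast-≤D j ε               asc          = asc
lastAscentAtLeast-≤D j (mv ◅ W₁≤W′) (X , h , eq) with peakMove X j h mv eq
... | beforePeak _ W₁≡   = lastAscentAtLeast-≤D j W₁≤W′ (_ , h , W₁≡)
... | intoPeak C l _ W₁≡ = lastAscentAtLeast-≤D j W₁≤W′ (C ++ replicate l U , suc h , W₁≡)

peak-unique : ∀ j A h B k →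
              A ++ replicate (suc j) U ++ replicate h D ≡ B ++ replicate (suc j) U ++ replicate k D →
              A ≡ B × h ≡ k
peak-unique j A h B k eq with finalDescent-unique
  (trans eq (sym (++-assoc B _ _)) , ¬endsWith-D-++-ups B j) (sym (++-assoc A _ _) , ¬endsWith-D-++-ups A j)
... | AU≡BU , h≡k = ++-cancelʳ (replicate (suc j) U) A B (sym AU≡BU) , sym h≡k

length-++-replicate : ∀ A {s : Step} j → length (A ++ replicate j s) ≡ length A + j
length-++-replicate A j = trans (length-++ A) (cong (length A +_) (length-replicate j))

length-++-replicate-++-replicate : ∀ A {s t : Step} j k →
                                   length (A ++ replicate j s ++ replicate k t) ≡ length A + (j + k)
length-++-replicate-++-replicate A j k =
  trans (length-++ A) (cong (length A +_)
    (trans (length-++ (replicate j _)) (cong₂ _+_ (length-replicate j) (length-replicate k))))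

-- Deleting the final large peak

module _ (m : ℕ) where

  deletePeak : Path → ℕ → Path
  deletePeak A h = A ++ replicate (h ∸ m) D

  nonNeg-deletePeak : ∀ A h {c} → NonNeg c (A ++ replicate m U ++ replicate h D) → NonNeg c (deletePeak A h)
  nonNeg-deletePeak A h = nonNeg-replace-suffix A delete
    where
    delete : ∀ {d} → NonNeg d (replicate m U ++ replicate h D) → NonNeg d (replicate (h ∸ m) D)
    delete {d} p = subst (λ z → NonNeg d (replicate z D)) d≡h∸m (nonNeg-downs⁺ d)
      where
      d≡h∸m : d ≡ h ∸ m
      d≡h∸m = trans (sym (m+n∸m≡n m d)) (cong (_∸ m) (nonNeg-downs⁻ h (nonNeg-ups⁻ m p)))

  length-deletePeak : ∀ n A h → m ≤ h → length (A ++ replicate m U ++ replicate h D) ≡ 2 * (m * suc n) →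
                      length (deletePeak A h) ≡ 2 * (m * n)
  length-deletePeak n A h m≤h len = +-cancelˡ-≡ (m + m) _ _ (begin
    (m + m) + length (A ++ replicate (h ∸ m) D)  ≡⟨ cong ((m + m) +_) (length-++-replicate A (h ∸ m)) ⟩
    (m + m) + (length A + (h ∸ m))               ≡⟨ shift (length A) m (h ∸ m) ⟩
    length A + (m + (m + (h ∸ m)))               ≡⟨ cong (λ z → length A + (m + z)) (m+[n∸m]≡n m≤h) ⟩
    length A + (m + h)                           ≡⟨ length-++-replicate-++-replicate A m h ⟨
    length (A ++ replicate m U ++ replicate h D) ≡⟨ len ⟩
    2 * (m * suc n)                              ≡⟨ double m n ⟩
    (m + m) + 2 * (m * n)                        ∎)
    where
    open ≡-Reasoning
    shift : ∀ L m t → (m + m) + (L + t) ≡ L + (m + (m + t))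
    shift = solve-∀
    double : ∀ m n → 2 * (m * suc n) ≡ (m + m) + 2 * (m * n)
    double = solve-∀

  upRuns-deletePeak : ∀ A h → UpRunsMultipleOf m (A ++ replicate m U ++ replicate h D) →
                      UpRunsMultipleOf m (deletePeak A h)
  upRuns-deletePeak A h runs X zero    Y eq ¬eX ¬sY ()
  upRuns-deletePeak A h runs X (suc k) Y eq ¬eX ¬sY k≥1
    with split-after (λ ()) (X ++ Uk) Y A (h ∸ m) (endsWith-++⁺ X (endsWith-replicate U k))
           (trans (++-assoc X Uk Y) (sym eq))
    where Uk = replicate (suc k) U
  -- the up-run ends where the deleted peak began, so it continued into that peak's U^m
  ... | [] , A≡ , _ =
    ∣m+n∣m⇒∣n (subst (m ∣_) (+-comm (suc k) m)
      (runs X (suc k + m) (replicate h D) merged ¬eX (¬startsWith-U-replicate-D h) (s≤s z≤n))) ∣-refl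
    where
    merged : A ++ replicate m U ++ replicate h D ≡ X ++ replicate (suc k + m) U ++ replicate h D
    merged = trans (cong (_++ _) (trans A≡ (++-identityʳ _))) (++-replicate-merge X U (suc k) m _)
  ... | z ∷ N , A≡ , Y≡ = runs X (suc k) (z ∷ N ++ replicate m U ++ replicate h D)
    (trans (cong (_++ _) A≡) (trans (++-assoc (X ++ replicate (suc k) U) (z ∷ N) _) (++-assoc X _ _)))
    ¬eX ¬sY′ k≥1
    where
    ¬sY′ : ¬ StartsWith U (z ∷ N ++ replicate m U ++ replicate h D)
    ¬sY′ (_ , eq) = ¬sY (N ++ replicate (h ∸ m) D , trans Y≡ (cong (λ w → w ∷ N ++ _) (∷-injectiveˡ eq)))

  inDmn-deletePeak : ∀ n A h → m ≤ h → InDmn m (suc n) (A ++ replicate m U ++ replicate h D) →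
                     InDmn m n (deletePeak A h)
  inDmn-deletePeak n A h m≤h ((nn , len) , runs) =
    (nonNeg-deletePeak A h nn , length-deletePeak n A h m≤h len) , upRuns-deletePeak A h runs

module _ (m₀ : ℕ) where
  private
    m : ℕ
    m = suc m₀

  deletePeak-⟶ : ∀ {W W′} A h → W ⟶ W′ → NonNeg 0 W → W ≡ A ++ replicate m U ++ replicate h D →
                 ∃₂ λ A′ h′ → W′ ≡ A′ ++ replicate m U ++ replicate h′ D ×
                              deletePeak m A h ≤D deletePeak m A′ h′
  deletePeak-⟶ A h mv nn eq with peakMove A m₀ h mv eq
  ... | beforePeak A⟶A′ W′≡ = _ , h , W′≡ , ⟶-++ʳ _ A⟶A′ ◅ ε
  ... | intoPeak C l refl W′≡ = C ++ replicate l U , suc h , W′≡ ,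
    subst (λ z → deletePeak m (C ++ D ∷ replicate l U) h ≤D ((C ++ replicate l U) ++ replicate z D))
          (sym (+-∸-assoc 1 m≤h)) (D-across-ups C l (h ∸ m) l≤h∸m)
    where
    m≤h : m ≤ h
    m≤h = nonNeg-peak (C ++ D ∷ replicate l U) m h (subst (NonNeg 0) eq nn)
    l≤h∸m : l ≤ h ∸ m
    l≤h∸m = nonNeg-peak (C ++ [ D ]) l (h ∸ m)
      (subst (NonNeg 0) (trans (++-assoc C _ _) (sym (++-assoc C [ D ] _)))
        (nonNeg-deletePeak m _ h (subst (NonNeg 0) eq nn)))

  deletePeak-≤D : ∀ {W W′} → W ≤D W′ → NonNeg 0 W → ∀ A h B k →
                  W ≡ A ++ replicate m U ++ replicate h D → W′ ≡ B ++ replicate m U ++ replicate k D →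
                  deletePeak m A h ≤D deletePeak m B k
  deletePeak-≤D ε _ A h B k eW eW′ with peak-unique m₀ A h B k (trans (sym eW) eW′)
  ... | refl , refl = ε
  deletePeak-≤D (mv ◅ W₁≤W′) nn A h B k eW eW′ with deletePeak-⟶ A h mv nn eW
  ... | A₁ , h₁ , eW₁ , del≤del₁ =
    del≤del₁ ◅◅ deletePeak-≤D W₁≤W′ (nonNeg-⟶ mv nn) A₁ h₁ B k eW₁ eW′

-- Inserting a large peak into the final descent

module _ (m₀ : ℕ) where
  private
    m : ℕ
    m = suc m₀

  -- the peak starts at height c of the final descent A D^f
  insertPeak : Path → ℕ → ℕ → Path
  insertPeak A f c = A ++ replicate (f ∸ c) D ++ replicate m U ++ replicate (m + c) D

  insertPeak-top : ∀ A f → insertPeak A f f ≡ A ++ replicate m U ++ replicate (m + f) D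
  insertPeak-top A f = cong (λ z → A ++ replicate z D ++ replicate m U ++ replicate (m + f) D) (n∸n≡0 f)

  insertPeak-finalDescent : ∀ A f c →
                            FinalDescent (insertPeak A f c) (A ++ replicate (f ∸ c) D ++ replicate m U) (m + c)
  insertPeak-finalDescent A f c =
    sym (++-assoc₃ A (replicate (f ∸ c) D) (replicate m U) (replicate (m + c) D)) ,
    endsWith-U⇒¬endsWith-D (endsWith-++⁺ A (endsWith-++⁺ (replicate (f ∸ c) D) (endsWith-replicate U m₀)))

  insertPeak-raise : ∀ A f c → c < f → insertPeak A f c ⟶ insertPeak A f (suc c)
  insertPeak-raise A (suc f) c (s≤s c≤f) rewrite +-∸-assoc 1 c≤f =
    subst₂ _⟶_ (trans (++-assoc A Dt _) (cong (A ++_) (sym (replicate-∷-++ D t _))))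
               (trans (++-assoc A Dt _)
                      (cong (λ z → A ++ Dt ++ replicate m U ++ D ∷ replicate z D) (sym (+-suc m₀ c))))
               (rot (A ++ Dt) (replicate (m₀ + c) D) m (s≤s z≤n))
    where
    t = f ∸ c
    Dt = replicate t D

  insertPeak-mono : ∀ A f {c d} → c ≤ d → d ≤ f → insertPeak A f c ≤D insertPeak A f d
  insertPeak-mono A f {d = zero}  z≤n _ = ε
  insertPeak-mono A f {c} {suc d} c≤d d<f with m≤n⇒m<n∨m≡n c≤d
  ... | inj₂ refl       = ε
  ... | inj₁ (s≤s c≤d′) = insertPeak-mono A f c≤d′ (<⇒≤ d<f) ◅◅ (insertPeak-raise A f d d<f ◅ ε)

  insertPeak-final-below : ∀ C k f c → c ≤ f →
    insertPeak (C ++ D ∷ replicate (suc k) U) (suc f) c ⟶ insertPeak (C ++ replicate (suc k) U) (suc (suc f)) c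
  insertPeak-final-below C k f c c≤f
    rewrite +-∸-assoc 1 c≤f | +-∸-assoc 1 (m≤n⇒m≤1+n c≤f) | +-∸-assoc 1 c≤f = rotate C k _

  insertPeak-final-top : ∀ C k f →
    insertPeak (C ++ D ∷ replicate (suc k) U) f f ⟶ insertPeak (C ++ replicate (suc k) U) (suc f) (suc f)
  insertPeak-final-top C k f =
    subst₂ _⟶_ (sym (trans (insertPeak-top (C ++ D ∷ R) f) (merge [ D ] _)))
               (sym (trans (insertPeak-top (C ++ R) (suc f))
                           (trans (merge [] _)
                                  (cong (λ z → (C ++ replicate (suc k + m) U) ++ D ∷ replicate z D) (+-suc m₀ f)))))
               (rotate C (k + m) (replicate (m₀ + f) D))
    where
    R = replicate (suc k) U
    merge : ∀ Y X → (C ++ Y ++ R) ++ replicate m U ++ X ≡ (C ++ Y ++ replicate (suc k + m) U) ++ X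
    merge Y X = begin
      (C ++ Y ++ R) ++ replicate m U ++ X    ≡⟨ ++-assoc (C ++ Y ++ R) _ X ⟨
      ((C ++ Y ++ R) ++ replicate m U) ++ X  ≡⟨ cong (_++ X) (trans (++-assoc C _ _) (cong (C ++_) (++-assoc Y R _))) ⟩
      (C ++ Y ++ R ++ replicate m U) ++ X    ≡⟨ cong (λ z → (C ++ Y ++ z) ++ X) (replicate-+ U (suc k) m) ⟨
      (C ++ Y ++ replicate (suc k + m) U) ++ X ∎
      where open ≡-Reasoning

  record InsertionsCompatible (A : Path) (f : ℕ) (A′ : Path) (f′ : ℕ) : Set where
    field
      descent-≤ : f ≤ f′
      below     : ∀ c → c < f → insertPeak A f c ≤D insertPeak A′ f′ c
      top       : insertPeak A f f ≤D insertPeak A′ f′ f′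

  open InsertionsCompatible

  insertionsCompatible-refl : ∀ A f → InsertionsCompatible A f A f
  insertionsCompatible-refl A f = record { descent-≤ = ≤-refl ; below = λ _ _ → ε ; top = ε }

  insertionsCompatible-trans : ∀ {A f A₁ f₁ A′ f′} → InsertionsCompatible A f A₁ f₁ →
                               InsertionsCompatible A₁ f₁ A′ f′ → InsertionsCompatible A f A′ f′
  insertionsCompatible-trans p q = record
    { descent-≤ = ≤-trans (descent-≤ p) (descent-≤ q)
    ; below     = λ c c<f → below p c c<f ◅◅ below q c (<-≤-trans c<f (descent-≤ p))
    ; top       = top p ◅◅ top q
    }

  insertionsCompatible-⟶ : ∀ {W W′ A f A′ f′} → W ⟶ W′ → FinalDescent W A f → FinalDescent W′ A′ f′ →
                           InsertionsCompatible A f A′ f′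
  insertionsCompatible-⟶ mv dW dW′ with finalDescentMove mv dW
  ... | internal A⟶A₁ W′≡
    with finalDescent-unique (W′≡ , λ e → proj₂ dW (⟶-reflects-endsWith-D A⟶A₁ e)) dW′
  ...   | refl , refl = record
    { descent-≤ = ≤-refl
    ; below     = λ _ _ → ⟶-++ʳ _ A⟶A₁ ◅ ε
    ; top       = ⟶-++ʳ _ A⟶A₁ ◅ ε
    }
  insertionsCompatible-⟶ mv dW dW′ | final C k f₁ refl refl W′≡
    with finalDescent-unique (W′≡ , ¬endsWith-D-++-ups C k) dW′
  ... | refl , refl = record
    { descent-≤ = n≤1+n _
    ; below     = λ { c (s≤s c≤f₁) → insertPeak-final-below C k f₁ c c≤f₁ ◅ ε }
    ; top       = insertPeak-final-top C k (suc f₁) ◅ ε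
    }

  insertionsCompatible : ∀ {W W′ A f A′ f′} → W ≤D W′ → FinalDescent W A f → FinalDescent W′ A′ f′ →
                         InsertionsCompatible A f A′ f′
  insertionsCompatible ε dW dW′ with finalDescent-unique dW dW′
  ... | refl , refl = insertionsCompatible-refl _ _
  insertionsCompatible (mv ◅ W₁≤W′) dW dW′ with finalDescent _
  ... | A₁ , f₁ , dW₁ =
    insertionsCompatible-trans (insertionsCompatible-⟶ mv dW dW₁) (insertionsCompatible W₁≤W′ dW₁ dW′)

  insertPeak-top-rigid : ∀ {P A a B b b′} → FinalDescent P A a → NonNeg 0 P →
                         length P ≡ length (B ++ replicate b D) → b′ ≤ b →
                         insertPeak A a a ≤D insertPeak B b b′ → b′ ≡ b
  insertPeak-top-rigid {A = []} {a} {B} {b} {b′} (refl , _) nn len b′≤b _ =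
    trans (n≤0⇒n≡0 (subst (b′ ≤_) b≡0 b′≤b)) (sym b≡0)
    where
    b≡0 : b ≡ 0
    b≡0 = m+n≡0⇒n≡0 (length B) (begin
      length B + b                ≡⟨ length-++-replicate B b ⟨
      length (B ++ replicate b D) ≡⟨ len ⟨
      length (replicate a D)      ≡⟨ length-replicate a ⟩
      a                           ≡⟨ nonNeg-downs⁻ a nn ⟨
      0                           ∎)
      where open ≡-Reasoning
  insertPeak-top-rigid {A = x ∷ A₁} (_ , ¬eA) nn len b′≤b r with endsWith-last x A₁
  ... | D , eD = ⊥-elim (¬eA eD)
  insertPeak-top-rigid {A = x ∷ A₁} {a} {B} {b} {b′} (_ , ¬eA) nn len b′≤b r | U , Z , A≡
    with lastAscentAtLeast-≤D m r
           (Z , m + a , trans (insertPeak-top _ a) (trans (cong (_++ _) A≡) (++-assoc Z [ U ] _)))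
  ... | X , g , eq with peak-unique m₀ (B ++ replicate (b ∸ b′) D) (m + b′) (X ++ [ U ]) g
                          (trans (++-assoc B _ _) (trans eq (sym (++-assoc X [ U ] _))))
  ...   | BD≡XU , _ = ≤-antisym b′≤b (m∸n≡0⇒m≤n (endsWith-U-++-downs B (b ∸ b′) (X , BD≡XU)))

  insertPeak-≤D⇔ : ∀ {P Q A a B b} → P ≤D Q → FinalDescent P A a → FinalDescent Q B b →
                   NonNeg 0 P → length P ≡ length Q → ∀ {a′ b′} → a′ ≤ a → b′ ≤ b →
                   insertPeak A a a′ ≤D insertPeak B b b′ ⇔ (a′ ≤ b′ × (a′ ≡ a → b′ ≡ b))
  insertPeak-≤D⇔ {A = A} {a} {B} {b} P≤Q dP dQ nn len {a′} {b′} a′≤a b′≤b = mk⇔ to from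
    where
    to : insertPeak A a a′ ≤D insertPeak B b b′ → a′ ≤ b′ × (a′ ≡ a → b′ ≡ b)
    to r = +-cancelˡ-≤ m a′ b′
             (descent-≤ (insertionsCompatible r (insertPeak-finalDescent A a a′) (insertPeak-finalDescent B b b′))) ,
           λ a′≡a → insertPeak-top-rigid {B = B} dP nn (trans len (cong length (proj₁ dQ))) b′≤b
                      (subst (λ z → insertPeak A a z ≤D insertPeak B b b′) a′≡a r)
    from : a′ ≤ b′ × (a′ ≡ a → b′ ≡ b) → insertPeak A a a′ ≤D insertPeak B b b′
    from (a′≤b′ , a′≡a⇒b′≡b) with m≤n⇒m<n∨m≡n a′≤a
    ... | inj₁ a′<a =
      below (insertionsCompatible P≤Q dP dQ) a′ a′<a ◅◅ insertPeak-mono B b a′≤b′ b′≤b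
    ... | inj₂ refl with a′≡a⇒b′≡b refl
    ...   | refl = top (insertionsCompatible P≤Q dP dQ)

lemma4p1 : ∀ (m : ℕ) → 1 ≤ m →
    ((n : ℕ) → 1 ≤ n → ∀ P' Q' → InDmn m n P' → InDmn m n Q' → P' ≤D Q' →
      ∀ A h B k →
      P' ≡ A ++ replicate m U ++ replicate h D → m ≤ h →
      Q' ≡ B ++ replicate m U ++ replicate k D → m ≤ k →
      InDmn m (n ∸ 1) (A ++ replicate (h ∸ m) D)
      × InDmn m (n ∸ 1) (B ++ replicate (k ∸ m) D)
      × (A ++ replicate (h ∸ m) D) ≤D (B ++ replicate (k ∸ m) D))
    ×
    ((n : ℕ) → 1 ≤ n → ∀ P Q → InDmn m (n ∸ 1) P → InDmn m (n ∸ 1) Q → P ≤D Q →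
      ∀ A a B b →
      P ≡ A ++ replicate a D → ¬ EndsWith D A →
      Q ≡ B ++ replicate b D → ¬ EndsWith D B →
      ∀ a' b' → a' ≤ a → b' ≤ b →
      ((A ++ replicate (a ∸ a') D ++ replicate m U ++ replicate (m + a') D)
         ≤D (B ++ replicate (b ∸ b') D ++ replicate m U ++ replicate (m + b') D))
      ⇔ (a' ≤ b' × (a' ≡ a → b' ≡ b)))
lemma4p1 zero     ()
lemma4p1 (suc m₀) _ =
  (λ { zero () ; (suc n) _ P′ Q′ inP′ inQ′ P′≤Q′ A h B k refl m≤h refl m≤k →
         inDmn-deletePeak (suc m₀) n A h m≤h inP′ ,
         inDmn-deletePeak (suc m₀) n B k m≤k inQ′ ,
         deletePeak-≤D m₀ P′≤Q′ (proj₁ (proj₁ inP′)) A h B k refl refl }) ,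
  (λ { n _ P Q ((nnP , lenP) , _) ((_ , lenQ) , _) P≤Q A a B b P≡ ¬eA Q≡ ¬eB a′ b′ a′≤a b′≤b →
         insertPeak-≤D⇔ m₀ P≤Q (P≡ , ¬eA) (Q≡ , ¬eB) nnP (trans lenP (sym lenQ)) a′≤a b′≤b })
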